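{- Let $\Pi$ be an integral parallelepiped in $\mathbb{R}^d$ with vertex set $X:=\mathrm{vert}(\Pi)$. Then for any $x^*\in\Pi\cap\mathbb{Z}^d$ and any $\lambda^*\in\mathbb{Z}_{\geq0}$ there is an integral vector $\mu\in\mathbb{Z}_{\geq0}^{\Pi\cap\mathbb{Z}^d}$ such that (1) $\lambda^*x^*=\sum_{x\in\Pi\cap\mathbb{Z}^d}\mu_x x$; (2) $|\mathrm{supp}(\mu)\setminus X|\leq 2^d$; (3) $\mu_x\in\{0,1\}$ for all $x\notin X$.
   Context: A parallelepiped is a set $\Pi=\{v_0+\sum_{i=1}^k\alpha_iv_i\mid |\alpha_i|\leq1\ \forall i=1,\ldots,k\}$ with center $v_0\in\mathbb{R}^d$ and linearly independent directions $v_1,\ldots,v_k\in\mathbb{R}^d$. It is called integral if all its $2^k$ vertices are integral (the center need not be integral). $\mathrm{supp}(\mu)=\{x\mid\mu_x\neq0\}$.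
   Formalization: The center $v_0$ and directions $v_1,\ldots,v_k$ of Π lie in ℚ^d rather than ℝ^d, and the coefficients $\alpha_i$ describing membership in Π are rational. -}

module Defs where

open import Data.Nat using (ℕ; zero; suc; _≤_)
open import Data.Integer as ℤ using (ℤ)
open import Data.Rational as ℚ using (ℚ; 0ℚ; 1ℚ; _/_)
open import Data.Fin using (Fin; zero; suc)
open import Data.Vec using (Vec; replicate; zipWith; map)
open import Data.Bool using (Bool; true; false)
open import Data.Product using (Σ; ∃; _×_; _,_; proj₁; proj₂)
open import Data.List using (List; []; _∷_)
import Data.List as List
open import Relation.Binary.PropositionalEquality using (_≡_)

QVec : ℕ → Set
QVec d = Vec ℚ d

ZVec : ℕ → Set
ZVec d = Vec ℤ d

toQ : ∀ {d} → ZVec d → QVec d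
toQ = map (λ z → z / 1)

_+ᵛ_ : ∀ {d} → QVec d → QVec d → QVec d
_+ᵛ_ = zipWith ℚ._+_

_·ᵛ_ : ∀ {d} → ℚ → QVec d → QVec d
a ·ᵛ v = map (a ℚ.*_) v

lincomb : ∀ {d} k → (Fin k → ℚ) → (Fin k → QVec d) → QVec d
lincomb zero    α v = replicate _ 0ℚ
lincomb (suc k) α v = (α zero ·ᵛ v zero) +ᵛ lincomb k (λ i → α (suc i)) (λ i → v (suc i))

LinIndep : ∀ {d} k → (Fin k → QVec d) → Set
LinIndep {d} k v = (c : Fin k → ℚ) → lincomb k c v ≡ replicate d 0ℚ → (i : Fin k) → c i ≡ 0ℚ

-- a parallelepiped {v0 + Σ α_i v_i | |α_i| ≤ 1}
record Parallelepiped (d : ℕ) : Set where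
  field
    k      : ℕ
    center : QVec d
    dir    : Fin k → QVec d
    indep  : LinIndep k dir
open Parallelepiped public

sign : Bool → ℚ
sign true  = 1ℚ
sign false = ℚ.- 1ℚ

vertexOf : ∀ {d} (P : Parallelepiped d) → (Fin (k P) → Bool) → QVec d
vertexOf P ε = center P +ᵛ lincomb (k P) (λ i → sign (ε i)) (dir P)

Integral : ∀ {d} → Parallelepiped d → Set
Integral {d} P = (ε : Fin (k P) → Bool) → Σ (ZVec d) λ z → toQ z ≡ vertexOf P ε

_∈Π_ : ∀ {d} → QVec d → Parallelepiped d → Set
x ∈Π P = Σ (Fin (k P) → ℚ) λ α → ((i : Fin (k P)) → ℚ.∣ α i ∣ ℚ.≤ 1ℚ)
                                 × (x ≡ center P +ᵛ lincomb (k P) α (dir P))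

IsVertex : ∀ {d} → Parallelepiped d → ZVec d → Set
IsVertex P x = Σ (Fin (k P) → Bool) λ ε → toQ x ≡ vertexOf P ε

_+ᶻ_ : ∀ {d} → ZVec d → ZVec d → ZVec d
_+ᶻ_ = zipWith ℤ._+_

_·ᶻ_ : ∀ {d} → ℕ → ZVec d → ZVec d
m ·ᶻ x = map (ℤ.+ m ℤ.*_) x

weightedSum : ∀ {d} → List (ZVec d × ℕ) → ZVec d
weightedSum {d} []            = replicate d (ℤ.+ 0)
weightedSum     ((x , m) ∷ L) = (m ·ᶻ x) +ᶻ weightedSum L

module Submission where

-- The heart of the proof is an exchange step: for lattice points p, q of Π with
-- coefficients α, β, let εᵢ be the sign of αᵢ + βᵢ and z the vertex of sign
-- vector ε. Then |αᵢ + βᵢ − εᵢ| ≤ 1, so r = p + q − z is again a lattice point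
-- of Π, and p + q = z + r.
--
-- Starting from 1·x* = x*, repeated exchange with x* writes (n+1)·x* as a
-- multiset of vertices plus a single remaining lattice point y of Π. Vertex-ness
-- of y is decidable (there are finitely many sign vectors): if y is a vertex it
-- joins the vertex multiset, otherwise it is the only non-vertex of the support,
-- with multiplicity 1, and 1 ≤ 2^d.

open import Defs
open import Data.Nat using (ℕ; _≤_; _^_; _≥_)
open import Data.Product using (Σ; _×_; _,_; proj₁; proj₂)
open import Data.List using (List; _++_; length; map)
open import Data.List.Relation.Unary.All using (All)
open import Data.List.Relation.Unary.Unique.Propositional using (Unique)
open import Relation.Nullary using (¬_)
open import Relation.Binary.PropositionalEquality using (_≡_)

import Data.Nat as ℕ
import Data.Nat.Properties as ℕP
open import Data.Integer as ℤ using (ℤ)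
import Data.Integer.Properties as ℤP
import Data.Integer.Solver as ℤSolver
open import Data.Rational as ℚ using (ℚ; 0ℚ; 1ℚ)
import Data.Rational.Properties as ℚP
import Data.Rational.Solver as ℚSolver
import Data.Rational.Unnormalised as ℚᵘ
import Data.Rational.Unnormalised.Properties as ℚᵘP
open import Data.Fin using (Fin; zero; suc)
open import Data.Fin.Subset.Properties using (anySubset?)
open import Data.Vec as Vec using (Vec; []; _∷_; lookup; replicate; tabulate)
import Data.Vec.Properties as VecP
open import Data.Vec.Relation.Binary.Pointwise.Extensional using (ext; Pointwise-≡⇒≡)
open import Data.Bool using (Bool; true; false)
open import Data.List using ([]; _∷_)
import Data.List.Properties as ListP
open import Data.List.Relation.Unary.All using ([]; _∷_)
import Data.List.Relation.Unary.All as All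
import Data.List.Relation.Unary.All.Properties as AllP
import Data.List.Relation.Unary.Unique.Propositional.Properties as UniqueP
open import Data.List.Relation.Unary.AllPairs using ([]; _∷_)
open import Data.List.Relation.Binary.Disjoint.Propositional using (Disjoint)
open import Data.Sum using (inj₁; inj₂)
open import Relation.Nullary using (Dec; yes; no; does)
import Relation.Nullary.Decidable as Dec
open import Relation.Binary.Definitions using (DecidableEquality)
open import Relation.Binary.PropositionalEquality
  using (refl; sym; trans; cong; cong₂; subst; module ≡-Reasoning)

private
  variable
    d n : ℕ

≡-by-coordinates : ∀ {A : Set} {u v : Vec A n} → (∀ j → lookup u j ≡ lookup v j) → u ≡ v
≡-by-coordinates h = Pointwise-≡⇒≡ (ext h)

0ᶻ : (d : ℕ) → ZVec d
0ᶻ d = replicate d (ℤ.+ 0)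

+ᶻ-assoc : (x y z : ZVec d) → (x +ᶻ y) +ᶻ z ≡ x +ᶻ (y +ᶻ z)
+ᶻ-assoc = VecP.zipWith-assoc ℤP.+-assoc

+ᶻ-comm : (x y : ZVec d) → x +ᶻ y ≡ y +ᶻ x
+ᶻ-comm = VecP.zipWith-comm ℤP.+-comm

+ᶻ-identityˡ : (x : ZVec d) → 0ᶻ d +ᶻ x ≡ x
+ᶻ-identityˡ = VecP.zipWith-identityˡ ℤP.+-identityˡ

+ᶻ-identityʳ : (x : ZVec d) → x +ᶻ 0ᶻ d ≡ x
+ᶻ-identityʳ = VecP.zipWith-identityʳ ℤP.+-identityʳ

+ᶻ-leftComm : (x y z : ZVec d) → x +ᶻ (y +ᶻ z) ≡ y +ᶻ (x +ᶻ z)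
+ᶻ-leftComm x y z = begin
  x +ᶻ (y +ᶻ z)  ≡⟨ +ᶻ-assoc x y z ⟨
  (x +ᶻ y) +ᶻ z  ≡⟨ cong (_+ᶻ z) (+ᶻ-comm x y) ⟩
  (y +ᶻ x) +ᶻ z  ≡⟨ +ᶻ-assoc y x z ⟩
  y +ᶻ (x +ᶻ z)  ∎
  where open ≡-Reasoning

·ᶻ-zero : (x : ZVec d) → 0 ·ᶻ x ≡ 0ᶻ d
·ᶻ-zero []      = refl
·ᶻ-zero (a ∷ x) = cong₂ _∷_ (ℤP.*-zeroˡ a) (·ᶻ-zero x)

·ᶻ-suc : ∀ m (x : ZVec d) → ℕ.suc m ·ᶻ x ≡ x +ᶻ (m ·ᶻ x)
·ᶻ-suc m []      = refl
·ᶻ-suc m (a ∷ x) = cong₂ _∷_ (ℤP.suc-* (ℤ.+ m) a) (·ᶻ-suc m x)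

·ᶻ-one : (x : ZVec d) → 1 ·ᶻ x ≡ x
·ᶻ-one x = trans (·ᶻ-suc 0 x) (trans (cong (x +ᶻ_) (·ᶻ-zero x)) (+ᶻ-identityʳ x))

ℤ-difference : ∀ a b → a ≡ b ℤ.+ (a ℤ.- b)
ℤ-difference = solve 2 (λ a b → a := b :+ (a :- b)) refl
  where open ℤSolver.+-*-Solver

_-ᶻ_ : ZVec d → ZVec d → ZVec d
_-ᶻ_ = Vec.zipWith ℤ._-_

+ᶻ-difference : (u w : ZVec d) → u ≡ w +ᶻ (u -ᶻ w)
+ᶻ-difference []      []      = refl
+ᶻ-difference (a ∷ u) (b ∷ w) = cong₂ _∷_ (ℤ-difference a b) (+ᶻ-difference u w)

weightedSum-++ : (L M : List (ZVec d × ℕ)) → weightedSum (L ++ M) ≡ weightedSum L +ᶻ weightedSum M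
weightedSum-++ []            M = sym (+ᶻ-identityˡ (weightedSum M))
weightedSum-++ ((x , m) ∷ L) M =
  trans (cong ((m ·ᶻ x) +ᶻ_) (weightedSum-++ L M)) (sym (+ᶻ-assoc (m ·ᶻ x) (weightedSum L) (weightedSum M)))

weightedSum-singleton : (y : ZVec d) → weightedSum ((y , 1) ∷ []) ≡ y
weightedSum-singleton y = trans (+ᶻ-identityʳ (1 ·ᶻ y)) (·ᶻ-one y)

-- Multisets of lattice points are lists of (point, multiplicity) pairs with distinct points.
_≟ᶻ_ : DecidableEquality (ZVec d)
_≟ᶻ_ = VecP.≡-dec ℤP._≟_

insert : ZVec d → List (ZVec d × ℕ) → List (ZVec d × ℕ)
insert z []            = (z , 1) ∷ []
insert z ((x , m) ∷ L) with z ≟ᶻ x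
... | yes _ = (x , ℕ.suc m) ∷ L
... | no  _ = (x , m) ∷ insert z L

weightedSum-insert : (z : ZVec d) (L : List (ZVec d × ℕ)) → weightedSum (insert z L) ≡ z +ᶻ weightedSum L
weightedSum-insert z []            = trans (weightedSum-singleton z) (sym (+ᶻ-identityʳ z))
weightedSum-insert z ((x , m) ∷ L) with z ≟ᶻ x
... | yes refl = trans (cong (_+ᶻ weightedSum L) (·ᶻ-suc m z)) (+ᶻ-assoc z (m ·ᶻ z) (weightedSum L))
... | no  _    = trans (cong ((m ·ᶻ x) +ᶻ_) (weightedSum-insert z L)) (+ᶻ-leftComm (m ·ᶻ x) z (weightedSum L))

insert-All : ∀ {R : ZVec d → Set} (z : ZVec d) (L : List (ZVec d × ℕ)) →
             R z → All (λ e → R (proj₁ e)) L → All (λ e → R (proj₁ e)) (insert z L)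
insert-All z []            rz []         = rz ∷ []
insert-All z ((x , m) ∷ L) rz (rx ∷ rL) with z ≟ᶻ x
... | yes _ = rx ∷ rL
... | no  _ = rx ∷ insert-All z L rz rL

insert-positive : (z : ZVec d) (L : List (ZVec d × ℕ)) →
                  All (λ e → proj₂ e ≥ 1) L → All (λ e → proj₂ e ≥ 1) (insert z L)
insert-positive z []            []         = ℕP.≤-refl ∷ []
insert-positive z ((x , m) ∷ L) (pm ∷ pL) with z ≟ᶻ x
... | yes _ = ℕ.s≤s ℕ.z≤n ∷ pL
... | no  _ = pm ∷ insert-positive z L pL

insert-unique : (z : ZVec d) (L : List (ZVec d × ℕ)) → Unique (map proj₁ L) → Unique (map proj₁ (insert z L))
insert-unique z []            []        = [] ∷ []
insert-unique z ((x , m) ∷ L) (x∉ ∷ uL) with z ≟ᶻ x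
... | yes _   = x∉ ∷ uL
... | no  z≢x = AllP.map⁺ (insert-All z L (λ x≡z → z≢x (sym x≡z)) (AllP.map⁻ x∉)) ∷ insert-unique z L uL

-- A vertex multiset of Π: distinct vertices of Π with positive multiplicities (together with
-- their membership in Π, which the conclusion of Lemma 9 records explicitly).
record VertexMultiset (P : Parallelepiped d) (L : List (ZVec d × ℕ)) : Set where
  field
    inΠ      : All (λ e → toQ (proj₁ e) ∈Π P) L
    distinct : Unique (map proj₁ L)
    positive : All (λ e → proj₂ e ≥ 1) L
    vertices : All (λ e → IsVertex P (proj₁ e)) L
open VertexMultiset

emptyVertexMultiset : (P : Parallelepiped d) → VertexMultiset P []
emptyVertexMultiset P = record { inΠ = [] ; distinct = [] ; positive = [] ; vertices = [] }

insert-vertex : ∀ {P : Parallelepiped d} {L} (z : ZVec d) → toQ z ∈Π P → IsVertex P z →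
                VertexMultiset P L → VertexMultiset P (insert z L)
insert-vertex {L = L} z z∈Π z-vertex V = record
  { inΠ      = insert-All z L z∈Π (inΠ V)
  ; distinct = insert-unique z L (distinct V)
  ; positive = insert-positive z L (positive V)
  ; vertices = insert-All z L z-vertex (vertices V)
  }

toℚ : ℤ → ℚ
toℚ z = z ℚ./ 1

toℚ-+ : ∀ a b → toℚ (a ℤ.+ b) ≡ toℚ a ℚ.+ toℚ b
toℚ-+ a b = ℚP.toℚᵘ-injective (begin
  ℚ.toℚᵘ (toℚ (a ℤ.+ b))                    ≈⟨ ℚP.toℚᵘ-fromℚᵘ (ℚᵘ.mkℚᵘ (a ℤ.+ b) 0) ⟩
  ℚᵘ.mkℚᵘ (a ℤ.+ b) 0                       ≈⟨ ℚᵘ.*≡* (solve 2 (λ a b → (a :+ b) :* con (ℤ.+ 1)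
                                                  := (a :* con (ℤ.+ 1) :+ b :* con (ℤ.+ 1)) :* con (ℤ.+ 1)) refl a b) ⟩
  ℚᵘ.mkℚᵘ a 0 ℚᵘ.+ ℚᵘ.mkℚᵘ b 0             ≈⟨ ℚᵘP.+-cong (ℚP.toℚᵘ-fromℚᵘ (ℚᵘ.mkℚᵘ a 0))
                                                            (ℚP.toℚᵘ-fromℚᵘ (ℚᵘ.mkℚᵘ b 0)) ⟨
  ℚ.toℚᵘ (toℚ a) ℚᵘ.+ ℚ.toℚᵘ (toℚ b)        ≈⟨ ℚP.toℚᵘ-homo-+ (toℚ a) (toℚ b) ⟨
  ℚ.toℚᵘ (toℚ a ℚ.+ toℚ b)                  ∎)
  where open ℚᵘP.≃-Reasoning
        open ℤSolver.+-*-Solver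

toℚ-- : ∀ a b → toℚ (a ℤ.- b) ≡ toℚ a ℚ.- toℚ b
toℚ-- a b = begin
  toℚ (a ℤ.- b)                          ≡⟨ solve 2 (λ u v → u := (v :+ u) :- v) refl (toℚ (a ℤ.- b)) (toℚ b) ⟩
  (toℚ b ℚ.+ toℚ (a ℤ.- b)) ℚ.- toℚ b    ≡⟨ cong (ℚ._- toℚ b) (toℚ-+ b (a ℤ.- b)) ⟨
  toℚ (b ℤ.+ (a ℤ.- b)) ℚ.- toℚ b        ≡⟨ cong (λ w → toℚ w ℚ.- toℚ b) (ℤ-difference a b) ⟨
  toℚ a ℚ.- toℚ b                        ∎
  where open ≡-Reasoning
        open ℚSolver.+-*-Solver

lookup-toQ : (z : ZVec d) (j : Fin d) → lookup (toQ z) j ≡ toℚ (lookup z j)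
lookup-toQ z j = VecP.lookup-map j _ z

lincombAt : ∀ n → (Fin n → ℚ) → (Fin n → QVec d) → Fin d → ℚ
lincombAt ℕ.zero    α v j = 0ℚ
lincombAt (ℕ.suc n) α v j =
  α zero ℚ.* lookup (v zero) j ℚ.+ lincombAt n (λ i → α (suc i)) (λ i → v (suc i)) j

lookup-lincomb : ∀ n α v (j : Fin d) → lookup (lincomb n α v) j ≡ lincombAt n α v j
lookup-lincomb ℕ.zero    α v j = VecP.lookup-replicate j 0ℚ
lookup-lincomb (ℕ.suc n) α v j = begin
  lookup ((α zero ·ᵛ v zero) +ᵛ lincomb n α′ v′) j
    ≡⟨ VecP.lookup-zipWith ℚ._+_ j (α zero ·ᵛ v zero) (lincomb n α′ v′) ⟩
  lookup (α zero ·ᵛ v zero) j ℚ.+ lookup (lincomb n α′ v′) j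
    ≡⟨ cong₂ ℚ._+_ (VecP.lookup-map j _ (v zero)) (lookup-lincomb n α′ v′ j) ⟩
  α zero ℚ.* lookup (v zero) j ℚ.+ lincombAt n α′ v′ j
    ∎
  where open ≡-Reasoning
        α′ = λ i → α (suc i)
        v′ = λ i → v (suc i)

lincombAt-affine : ∀ n (α β σ : Fin n → ℚ) (v : Fin n → QVec d) j →
  lincombAt n (λ i → (α i ℚ.+ β i) ℚ.- σ i) v j
    ≡ (lincombAt n α v j ℚ.+ lincombAt n β v j) ℚ.- lincombAt n σ v j
lincombAt-affine ℕ.zero    α β σ v j = refl
lincombAt-affine (ℕ.suc n) α β σ v j
  rewrite lincombAt-affine n (λ i → α (suc i)) (λ i → β (suc i)) (λ i → σ (suc i)) (λ i → v (suc i)) j =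
  solve 7 (λ a b s w x y z → ((a :+ b) :- s) :* w :+ ((x :+ y) :- z)
                          := ((a :* w :+ x) :+ (b :* w :+ y)) :- (s :* w :+ z))
        refl (α zero) (β zero) (σ zero) (lookup (v zero) j) _ _ _
  where open ℚSolver.+-*-Solver

lincomb-cong : ∀ n {α β : Fin n → ℚ} (v : Fin n → QVec d) → (∀ i → α i ≡ β i) →
               lincomb n α v ≡ lincomb n β v
lincomb-cong ℕ.zero    v α≗β = refl
lincomb-cong (ℕ.suc n) v α≗β =
  cong₂ _+ᵛ_ (cong (_·ᵛ v zero) (α≗β zero)) (lincomb-cong n (λ i → v (suc i)) (λ i → α≗β (suc i)))

lookup-affine : (c : QVec d) (α : Fin n → ℚ) (v : Fin n → QVec d) (j : Fin d) →
                lookup (c +ᵛ lincomb n α v) j ≡ lookup c j ℚ.+ lincombAt n α v j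
lookup-affine {n = n} c α v j =
  trans (VecP.lookup-zipWith ℚ._+_ j c _) (cong (lookup c j ℚ.+_) (lookup-lincomb n α v j))

coordinate : (c : QVec d) (v : Fin n → QVec d) {p : ZVec d} {α : Fin n → ℚ} →
             toQ p ≡ c +ᵛ lincomb n α v → ∀ j → toℚ (lookup p j) ≡ lookup c j ℚ.+ lincombAt n α v j
coordinate c v {p} {α} p≡ j =
  trans (sym (lookup-toQ p j)) (trans (cong (λ w → lookup w j) p≡) (lookup-affine c α v j))

lookup-toQ-combination : (p q z : ZVec d) (j : Fin d) →
  lookup (toQ ((p +ᶻ q) -ᶻ z)) j ≡ (toℚ (lookup p j) ℚ.+ toℚ (lookup q j)) ℚ.- toℚ (lookup z j)
lookup-toQ-combination p q z j = begin
  lookup (toQ ((p +ᶻ q) -ᶻ z)) j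
    ≡⟨ lookup-toQ ((p +ᶻ q) -ᶻ z) j ⟩
  toℚ (lookup ((p +ᶻ q) -ᶻ z) j)
    ≡⟨ cong toℚ (VecP.lookup-zipWith ℤ._-_ j (p +ᶻ q) z) ⟩
  toℚ (lookup (p +ᶻ q) j ℤ.- lookup z j)
    ≡⟨ toℚ-- (lookup (p +ᶻ q) j) (lookup z j) ⟩
  toℚ (lookup (p +ᶻ q) j) ℚ.- toℚ (lookup z j)
    ≡⟨ cong (λ w → toℚ w ℚ.- toℚ (lookup z j)) (VecP.lookup-zipWith ℤ._+_ j p q) ⟩
  toℚ (lookup p j ℤ.+ lookup q j) ℚ.- toℚ (lookup z j)
    ≡⟨ cong (ℚ._- toℚ (lookup z j)) (toℚ-+ (lookup p j) (lookup q j)) ⟩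
  (toℚ (lookup p j) ℚ.+ toℚ (lookup q j)) ℚ.- toℚ (lookup z j)
    ∎
  where open ≡-Reasoning

affine-combination : (c : QVec d) (v : Fin n → QVec d) {p q z : ZVec d} {α β σ : Fin n → ℚ} →
  toQ p ≡ c +ᵛ lincomb n α v → toQ q ≡ c +ᵛ lincomb n β v → toQ z ≡ c +ᵛ lincomb n σ v →
  toQ ((p +ᶻ q) -ᶻ z) ≡ c +ᵛ lincomb n (λ i → (α i ℚ.+ β i) ℚ.- σ i) v
affine-combination {n = n} c v {p} {q} {z} {α} {β} {σ} hp hq hz = ≡-by-coordinates λ j →
  let cⱼ = lookup c j
      A = lincombAt n α v j
      B = lincombAt n β v j
      S = lincombAt n σ v j
  in begin
  lookup (toQ ((p +ᶻ q) -ᶻ z)) j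
    ≡⟨ lookup-toQ-combination p q z j ⟩
  (toℚ (lookup p j) ℚ.+ toℚ (lookup q j)) ℚ.- toℚ (lookup z j)
    ≡⟨ cong₂ ℚ._-_ (cong₂ ℚ._+_ (coordinate c v hp j) (coordinate c v hq j)) (coordinate c v hz j) ⟩
  ((cⱼ ℚ.+ A) ℚ.+ (cⱼ ℚ.+ B)) ℚ.- (cⱼ ℚ.+ S)
    ≡⟨ solve 4 (λ c a b s → ((c :+ a) :+ (c :+ b)) :- (c :+ s) := c :+ ((a :+ b) :- s)) refl cⱼ A B S ⟩
  cⱼ ℚ.+ ((A ℚ.+ B) ℚ.- S)
    ≡⟨ cong (cⱼ ℚ.+_) (lincombAt-affine n α β σ v j) ⟨
  cⱼ ℚ.+ lincombAt n (λ i → (α i ℚ.+ β i) ℚ.- σ i) v j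
    ≡⟨ lookup-affine c (λ i → (α i ℚ.+ β i) ℚ.- σ i) v j ⟨
  lookup (c +ᵛ lincomb n (λ i → (α i ℚ.+ β i) ℚ.- σ i) v) j
    ∎
  where open ≡-Reasoning
        open ℚSolver.+-*-Solver

-1≤0 : ℚ.- 1ℚ ℚ.≤ 0ℚ
-1≤0 = ℚ.*≤* ℤ.-≤+

0≤1 : 0ℚ ℚ.≤ 1ℚ
0≤1 = ℚ.*≤* (ℤ.+≤+ ℕ.z≤n)

neg-involutive : ∀ x → ℚ.- (ℚ.- x) ≡ x
neg-involutive = solve 1 (λ x → :- (:- x) := x) refl
  where open ℚSolver.+-*-Solver

∣x∣≤1⇒bounds : ∀ x → ℚ.∣ x ∣ ℚ.≤ 1ℚ → ℚ.- 1ℚ ℚ.≤ x × x ℚ.≤ 1ℚ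
∣x∣≤1⇒bounds x ∣x∣≤1 with ℚP.∣p∣≡p∨∣p∣≡-p x
... | inj₁ ∣x∣≡x  = ℚP.≤-trans -1≤0 (subst (0ℚ ℚ.≤_) ∣x∣≡x (ℚP.0≤∣p∣ x))
                  , subst (ℚ._≤ 1ℚ) ∣x∣≡x ∣x∣≤1
... | inj₂ ∣x∣≡-x = subst (ℚ.- 1ℚ ℚ.≤_) (neg-involutive x)
                      (ℚP.neg-antimono-≤ (subst (ℚ._≤ 1ℚ) ∣x∣≡-x ∣x∣≤1))
                  , ℚP.≤-trans (subst (ℚ._≤ 0ℚ) (neg-involutive x)
                                  (ℚP.neg-antimono-≤ (subst (0ℚ ℚ.≤_) ∣x∣≡-x (ℚP.0≤∣p∣ x)))) 0≤1

bounds⇒∣x∣≤1 : ∀ x → ℚ.- 1ℚ ℚ.≤ x → x ℚ.≤ 1ℚ → ℚ.∣ x ∣ ℚ.≤ 1ℚ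
bounds⇒∣x∣≤1 x -1≤x x≤1 with ℚP.∣p∣≡p∨∣p∣≡-p x
... | inj₁ ∣x∣≡x  = subst (ℚ._≤ 1ℚ) (sym ∣x∣≡x) x≤1
... | inj₂ ∣x∣≡-x = subst (ℚ._≤ 1ℚ) (sym ∣x∣≡-x) (ℚP.neg-antimono-≤ -1≤x)

isNonNegative : ℚ → Bool
isNonNegative x = does (0ℚ ℚ.≤? x)

round-by-sign : ∀ a b → ℚ.∣ a ∣ ℚ.≤ 1ℚ → ℚ.∣ b ∣ ℚ.≤ 1ℚ →
                ℚ.∣ (a ℚ.+ b) ℚ.- sign (isNonNegative (a ℚ.+ b)) ∣ ℚ.≤ 1ℚ
round-by-sign a b ∣a∣≤1 ∣b∣≤1 =
  by-cases (0ℚ ℚ.≤? (a ℚ.+ b)) (∣x∣≤1⇒bounds a ∣a∣≤1) (∣x∣≤1⇒bounds b ∣b∣≤1)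
  where
  by-cases : (D : Dec (0ℚ ℚ.≤ a ℚ.+ b)) →
             ℚ.- 1ℚ ℚ.≤ a × a ℚ.≤ 1ℚ → ℚ.- 1ℚ ℚ.≤ b × b ℚ.≤ 1ℚ →
             ℚ.∣ (a ℚ.+ b) ℚ.- sign (does D) ∣ ℚ.≤ 1ℚ
  by-cases (yes 0≤a+b) (_ , a≤1) (_ , b≤1) =
    bounds⇒∣x∣≤1 _ (ℚP.+-monoˡ-≤ (ℚ.- 1ℚ) 0≤a+b) (ℚP.+-monoˡ-≤ (ℚ.- 1ℚ) (ℚP.+-mono-≤ a≤1 b≤1))
  by-cases (no 0≰a+b) (-1≤a , _) (-1≤b , _) =
    bounds⇒∣x∣≤1 _ (ℚP.+-monoˡ-≤ (ℚ.- (ℚ.- 1ℚ)) (ℚP.+-mono-≤ -1≤a -1≤b))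
                   (ℚP.+-monoˡ-≤ (ℚ.- (ℚ.- 1ℚ)) (ℚP.<⇒≤ (ℚP.≰⇒> 0≰a+b)))

∣sign∣≤1 : ∀ b → ℚ.∣ sign b ∣ ℚ.≤ 1ℚ
∣sign∣≤1 true  = ℚP.≤-refl
∣sign∣≤1 false = ℚP.≤-refl

vertex∈Π : (P : Parallelepiped d) {z : ZVec d} → IsVertex P z → toQ z ∈Π P
vertex∈Π P (ε , z≡) = (λ i → sign (ε i)) , (λ i → ∣sign∣≤1 (ε i)) , z≡

vertexOf-cong : (P : Parallelepiped d) {ε ε′ : Fin (k P) → Bool} → (∀ i → ε i ≡ ε′ i) →
                vertexOf P ε ≡ vertexOf P ε′
vertexOf-cong P ε≗ε′ = cong (center P +ᵛ_) (lincomb-cong (k P) (dir P) (λ i → cong sign (ε≗ε′ i)))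

-- Being a vertex is decidable: search all 2^k sign vectors, encoded as subsets of Fin k.
isVertex? : (P : Parallelepiped d) (y : ZVec d) → Dec (IsVertex P y)
isVertex? P y =
  Dec.map′ (λ (s , y≡) → lookup s , y≡)
           (λ (ε , y≡) → tabulate ε , trans y≡ (vertexOf-cong P (λ i → sym (VecP.lookup∘tabulate ε i))))
           (anySubset? (λ s → VecP.≡-dec ℚP._≟_ (toQ y) (vertexOf P (lookup s))))

VertexSplit : (P : Parallelepiped d) → ZVec d → Set
VertexSplit {d} P s = Σ (ZVec d) λ z → Σ (ZVec d) λ r → IsVertex P z × toQ r ∈Π P × (s ≡ z +ᶻ r)

-- The sum of two lattice points p, q of an integral Π splits: z has sign vector sign(α + β),
-- and r = p + q − z has coefficients α + β − sign(α + β), which lie in [−1, 1].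
exchange : (P : Parallelepiped d) → Integral P → (p q : ZVec d) → toQ p ∈Π P → toQ q ∈Π P →
           VertexSplit P (p +ᶻ q)
exchange {d} P I p q (α , ∣α∣≤1 , p≡) (β , ∣β∣≤1 , q≡) =
  z , (p +ᶻ q) -ᶻ z , (ε , z≡) ,
  (γ , ∣γ∣≤1 , affine-combination (center P) (dir P) p≡ q≡ z≡) ,
  +ᶻ-difference (p +ᶻ q) z
  where
    ε : Fin (k P) → Bool
    ε i = isNonNegative (α i ℚ.+ β i)
    z : ZVec d
    z = proj₁ (I ε)
    z≡ : toQ z ≡ vertexOf P ε
    z≡ = proj₂ (I ε)
    γ : Fin (k P) → ℚ
    γ i = (α i ℚ.+ β i) ℚ.- sign (ε i)
    ∣γ∣≤1 : ∀ i → ℚ.∣ γ i ∣ ℚ.≤ 1ℚ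
    ∣γ∣≤1 i = round-by-sign (α i) (β i) (∣α∣≤1 i) (∣β∣≤1 i)

record Decomposition (P : Parallelepiped d) (m : ℕ) (x : ZVec d) : Set where
  field
    vertexPart  : List (ZVec d × ℕ)
    multiset    : VertexMultiset P vertexPart
    remainder   : ZVec d
    remainder∈Π : toQ remainder ∈Π P
    splits      : m ·ᶻ x ≡ weightedSum vertexPart +ᶻ remainder
open Decomposition

decomposition-step : (P : Parallelepiped d) → Integral P → {x : ZVec d} → toQ x ∈Π P →
                     ∀ {m} → Decomposition P m x → Decomposition P (ℕ.suc m) x
decomposition-step {d} P I {x} x∈Π {m} D = extend (exchange P I y x (remainder∈Π D) x∈Π)
  where
  L : List (ZVec d × ℕ)
  L = vertexPart D
  W : ZVec d
  W = weightedSum L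
  y : ZVec d
  y = remainder D
  extend : VertexSplit P (y +ᶻ x) → Decomposition P (ℕ.suc m) x
  extend (z , r , z-vertex , r∈Π , y+x≡z+r) = record
    { vertexPart  = insert z L
    ; multiset    = insert-vertex z (vertex∈Π P z-vertex) z-vertex (multiset D)
    ; remainder   = r
    ; remainder∈Π = r∈Π
    ; splits      = begin
        ℕ.suc m ·ᶻ x                    ≡⟨ ·ᶻ-suc m x ⟩
        x +ᶻ (m ·ᶻ x)                   ≡⟨ cong (x +ᶻ_) (splits D) ⟩
        x +ᶻ (W +ᶻ y)                   ≡⟨ +ᶻ-leftComm x W y ⟩
        W +ᶻ (x +ᶻ y)                   ≡⟨ cong (W +ᶻ_) (trans (+ᶻ-comm x y) y+x≡z+r) ⟩
        W +ᶻ (z +ᶻ r)                   ≡⟨ +ᶻ-leftComm W z r ⟩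
        z +ᶻ (W +ᶻ r)                   ≡⟨ +ᶻ-assoc z W r ⟨
        (z +ᶻ W) +ᶻ r                   ≡⟨ cong (_+ᶻ r) (weightedSum-insert z L) ⟨
        weightedSum (insert z L) +ᶻ r   ∎
    }
    where open ≡-Reasoning

decompose : (P : Parallelepiped d) → Integral P → (x : ZVec d) → toQ x ∈Π P →
            ∀ m → Decomposition P (ℕ.suc m) x
decompose P I x x∈Π ℕ.zero = record
  { vertexPart  = []
  ; multiset    = emptyVertexMultiset P
  ; remainder   = x
  ; remainder∈Π = x∈Π
  ; splits      = trans (·ᶻ-one x) (sym (+ᶻ-identityˡ x))
  }
decompose P I x x∈Π (ℕ.suc m) = decomposition-step P I x∈Π (decompose P I x x∈Π m)

Representation : (P : Parallelepiped d) → ℕ → ZVec d → Set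
Representation {d} P m x =
  Σ (List (ZVec d × ℕ)) λ Lv → Σ (List (ZVec d × ℕ)) λ Ln →
    All (λ p → toQ (proj₁ p) ∈Π P) (Lv ++ Ln)
    × Unique (map proj₁ (Lv ++ Ln))
    × All (λ p → proj₂ p ≥ 1) (Lv ++ Ln)
    × All (λ p → IsVertex P (proj₁ p)) Lv
    × All (λ p → ¬ IsVertex P (proj₁ p)) Ln
    × (m ·ᶻ x ≡ weightedSum (Lv ++ Ln))
    × length Ln ≤ 2 ^ d
    × All (λ p → proj₂ p ≡ 1) Ln

-- A vertex multiset Lv plus at most 2^d distinct non-vertex points of Π with multiplicity 1
-- summing to m·x is a representation; the two parts are disjoint since one consists of vertices.
represent : ∀ {P : Parallelepiped d} {m x} (Lv Ln : List (ZVec d × ℕ)) → VertexMultiset P Lv →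
            All (λ p → toQ (proj₁ p) ∈Π P) Ln → Unique (map proj₁ Ln) →
            All (λ p → ¬ IsVertex P (proj₁ p)) Ln → All (λ p → proj₂ p ≡ 1) Ln → length Ln ≤ 2 ^ d →
            m ·ᶻ x ≡ weightedSum Lv +ᶻ weightedSum Ln → Representation P m x
represent Lv Ln V Ln∈Π Ln-distinct Ln-nonvertex Ln-simple Ln-size m·x≡ =
  Lv , Ln ,
  AllP.++⁺ (inΠ V) Ln∈Π ,
  subst Unique (sym (ListP.map-++ proj₁ Lv Ln)) (UniqueP.++⁺ (distinct V) Ln-distinct disjoint) ,
  AllP.++⁺ (positive V) (All.map (λ m≡1 → ℕP.≤-reflexive (sym m≡1)) Ln-simple) ,
  vertices V , Ln-nonvertex ,
  trans m·x≡ (sym (weightedSum-++ Lv Ln)) ,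
  Ln-size , Ln-simple
  where
    disjoint : Disjoint (map proj₁ Lv) (map proj₁ Ln)
    disjoint (y∈Lv , y∈Ln) = All.lookup (AllP.map⁺ Ln-nonvertex) y∈Ln (All.lookup (AllP.map⁺ (vertices V)) y∈Lv)

conclude : (P : Parallelepiped d) {m : ℕ} {x : ZVec d} → Decomposition P m x → Representation P m x
conclude {d} P {m} {x} D = by-cases (isVertex? P y)
  where
  L : List (ZVec d × ℕ)
  L = vertexPart D
  W : ZVec d
  W = weightedSum L
  y : ZVec d
  y = remainder D
  by-cases : Dec (IsVertex P y) → Representation P m x
  by-cases (yes y-vertex) =
    represent {P = P} {m} {x} (insert y L) [] (insert-vertex y (remainder∈Π D) y-vertex (multiset D))
      [] [] [] [] ℕ.z≤n
      (trans (splits D) (trans (+ᶻ-comm W y) (trans (sym (weightedSum-insert y L)) (sym (+ᶻ-identityʳ _)))))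
  by-cases (no y-nonvertex) =
    represent {P = P} {m} {x} L ((y , 1) ∷ []) (multiset D)
      (remainder∈Π D ∷ []) ([] ∷ []) (y-nonvertex ∷ []) (refl ∷ []) (ℕP.m^n>0 2 d)
      (trans (splits D) (cong (W +ᶻ_) (sym (weightedSum-singleton y))))

lemma9 : (d : ℕ) (P : Parallelepiped d) → Integral P →
    (xstar : ZVec d) → toQ xstar ∈Π P → (λstar : ℕ) →
    Σ (List (ZVec d × ℕ)) λ Lv → Σ (List (ZVec d × ℕ)) λ Ln →
    All (λ p → toQ (proj₁ p) ∈Π P) (Lv ++ Ln)
    × Unique (map proj₁ (Lv ++ Ln))
    × All (λ p → proj₂ p ≥ 1) (Lv ++ Ln)
    × All (λ p → IsVertex P (proj₁ p)) Lv
    × All (λ p → ¬ IsVertex P (proj₁ p)) Ln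
    × (λstar ·ᶻ xstar ≡ weightedSum (Lv ++ Ln))
    × length Ln ≤ 2 ^ d
    × All (λ p → proj₂ p ≡ 1) Ln
lemma9 d P I xstar xstar∈Π ℕ.zero =
  represent {P = P} {0} {xstar} [] [] (emptyVertexMultiset P) [] [] [] [] ℕ.z≤n
    (trans (·ᶻ-zero xstar) (sym (+ᶻ-identityˡ (0ᶻ d))))
lemma9 d P I xstar xstar∈Π (ℕ.suc m) = conclude P (decompose P I xstar xstar∈Π m)
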